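{- Let $G$ be a finite simple graph containing a vertex $v$ of valency $1$ whose unique neighbour is $u$. Then \[ J(G)=(1+x)J(G-v)+x(y-1)\Bigl(J((G-v)\backslash u)+y^{|N_G(u)|-1}J(G-N_G[u])\Bigr). \]
   Context: For a finite simple graph $G$ and $W\subseteq V(G)$, $N_G[W]$ is the set of vertices that are in $W$ or adjacent to a vertex of $W$, and $N_G(W):=N_G[W]\setminus W$; for a vertex $a$, $N_G(a)$ is the set of neighbours of $a$ (its valency is $|N_G(a)|$) and $N_G[a]=N_G(a)\cup\{a\}$. The bivariate domination polynomial is $J(G;x,y)=J(G):=\sum_{W\subseteq V(G)} x^{|W|}y^{|N_G(W)|}$ (the graph with no vertices has $J=1$). For $X\subseteq V(G)$, $G-X$ is obtained by deleting the vertices of $X$. For a graph $H$ and vertex $a$ of $H$, the vertex contraction $H\backslash a$ is the graph obtained from $H$ by adding edges between all pairs of vertices of $N_H(a)$ and then deleting $a$. -}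

module Defs where

open import Data.Nat using (ℕ; zero; suc; _∸_)
open import Data.Bool using (Bool; true; false; _∧_; _∨_; not)
open import Data.Fin using (Fin; _≟_)
open import Data.Fin.Subset using (Subset; ∣_∣; _∩_; _∪_; ∁; ⁅_⁆)
open import Data.Vec using (Vec; []; _∷_; lookup; tabulate)
open import Data.List as List using (List; []; _∷_; allFin; _++_)
open import Data.Bool.ListAction using (any)
open import Relation.Nullary.Decidable using (⌊_⌋)
open import Relation.Binary.PropositionalEquality using (_≡_)
open import Algebra.Bundles using (CommutativeRing)
open import Level using (Level)

-- A (raw) graph: vertex set V ⊆ Fin n and an adjacency relation on Fin n.
-- Only adjacencies between vertices of V count (see `edge`).
record Graph : Set where
  constructor mkGraph
  field
    size : ℕ
    V    : Subset size
    adj  : Fin size → Fin size → Bool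
open Graph public

edge : (G : Graph) → Fin (size G) → Fin (size G) → Bool
edge G i j = lookup (V G) i ∧ lookup (V G) j ∧ adj G i j

IsSimple : Graph → Set
IsSimple G = (∀ i j → adj G i j ≡ adj G j i) × (∀ i → adj G i i ≡ false)
  where open import Data.Product using (_×_)

_⊖_ : (G : Graph) → Subset (size G) → Graph
G ⊖ X = mkGraph (size G) (V G ∩ ∁ X) (adj G)

-- H \ a : join all pairs of neighbours of a, then delete a
_\\_ : (H : Graph) → Fin (size H) → Graph
H \\ a = mkGraph (size H) (V H ∩ ∁ ⁅ a ⁆)
  (λ i j → adj H i j ∨ (edge H a i ∧ edge H a j ∧ not ⌊ i ≟ j ⌋))

N₁ : (G : Graph) → Fin (size G) → Subset (size G)
N₁ G a = tabulate (λ w → edge G a w)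

N₁[_] : (G : Graph) → Fin (size G) → Subset (size G)
N₁[ G ] a = N₁ G a ∪ ⁅ a ⁆

N : (G : Graph) → Subset (size G) → Subset (size G)
N G W = tabulate (λ j → lookup (V G) j ∧ not (lookup W j)
          ∧ any (λ i → lookup W i ∧ edge G i j) (allFin (size G)))

subsetsOf : {n : ℕ} → Subset n → List (Subset n)
subsetsOf [] = [] ∷ []
subsetsOf (false ∷ S) = List.map (false ∷_) (subsetsOf S)
subsetsOf (true ∷ S) = List.map (false ∷_) (subsetsOf S) ++ List.map (true ∷_) (subsetsOf S)

module Poly {c ℓ : Level} (R : CommutativeRing c ℓ) where
  open CommutativeRing R

  pow : Carrier → ℕ → Carrier
  pow a zero = 1#
  pow a (suc k) = a * pow a k

  sumL : List Carrier → Carrier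
  sumL = List.foldr _+_ 0#

  -- bivariate domination polynomial J(G;x,y) evaluated in R
  J : Graph → Carrier → Carrier → Carrier
  J G x y = sumL (List.map (λ W → pow x ∣ W ∣ * pow y ∣ N G W ∣) (subsetsOf (V G)))

module Submission where

-- Let v be a pendant vertex of the simple graph G with neighbour u, H = G - v,
-- C = H \ u and D = G - N_G[u], which equals H - N_H[u].  Every subset of V(G) is
-- uniquely W, W + v, W + u or W + u + v with W ⊆ V(C) = V(G) - {u, v}, and J(H),
-- J(C), J(D) are sums over subsets of V(C) too, so the identity is proved summand
-- by summand.  Writing t_K(W) = x^|W| y^|N_K(W)| and X = x^|W|, it splits in two:
--   pendant step:     t_G(W) + t_G(W+v) + t_G(W+u) + t_G(W+u+v)
--                       = (1+x)(t_H(W) + t_H(W+u)) + x(y-1)·L(W),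
--   contraction step: L(W) = t_C(W) + y^|N_H(u)|·[W ⊆ V(D)]·t_D(W),
-- where L(W) = X·(y^|N_H(W+u)| + [u ∉ N_H(W)]·y^|N_H(W)|); the contraction step
-- holds for any vertex u of any simple graph H.

open import Defs
open import Data.Nat using (ℕ; _∸_)
open import Data.Bool using (true)
open import Data.Fin using (Fin)
open import Data.Fin.Subset using (∣_∣; ⁅_⁆)
open import Data.Vec using (lookup)
open import Data.Product using (_×_)
open import Relation.Binary.PropositionalEquality using (_≡_)
open import Algebra.Bundles using (CommutativeRing)
open import Level using (Level)

open import Data.Nat using (zero; suc) renaming (_+_ to _+ℕ_)
open import Data.Nat.Properties using (+-suc) renaming (+-comm to +ℕ-comm)
open import Data.Bool using (false; T; not; if_then_else_)
open import Data.Bool.Properties using (T-≡; T-∧; T-∨; ∧-identityʳ)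
open import Data.Unit using (tt)
open import Data.Empty using (⊥-elim)
open import Data.Fin using (zero; suc; _≟_)
open import Data.Fin.Subset using (Subset; _∈_; _∉_; _⊆_; _∩_; _∪_; ∁; ⊥)
open import Data.Fin.Subset.Properties
  using (_∈?_; _⊆?_; x∈p∩q⁺; x∈p∩q⁻; x∈p∪q⁺; x∈p∪q⁻; x∉p⇒x∈∁p; x∈∁p⇒x∉p;
         x∈⁅x⁆; x∈⁅y⁆⇒x≡y; x≢y⇒x∉⁅y⁆; x∉⁅y⁆⇒x≢y; ∣⁅x⁆∣≡1; ⊆-antisym; ∪-identityʳ; drop-∷-⊆; out⊆; s⊆s)
open import Data.Vec using (_∷_; []; here; there)
open import Data.Vec.Properties using (lookup∘tabulate; []=⇒lookup; lookup⇒[]=)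
open import Data.List as L using (allFin; _++_)
open import Data.List.Properties using (map-∘; map-++)
open import Data.List.Membership.Propositional using (lose)
open import Data.List.Membership.Propositional.Properties using (∈-allFin)
open import Data.List.Relation.Unary.Any using (satisfied)
open import Data.List.Relation.Unary.Any.Properties using (any⁺; any⁻)
open import Data.Product using (∃; _,_; proj₁; proj₂)
open import Data.Sum using (_⊎_; inj₁; inj₂)
open import Function using (_∘_)
open import Function.Bundles using (Equivalence)
open import Relation.Nullary using (¬_; Dec; yes; no; does)
open import Relation.Nullary.Decidable using (⌊_⌋)
import Relation.Binary.PropositionalEquality as ≡
open import Relation.Binary.PropositionalEquality using (_≢_; refl; sym; trans; cong; cong₂; subst; module ≡-Reasoning)

open Equivalence using (to; from)

import Algebra.Solver.Ring.NaturalCoefficients.Default as NC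

∈⇒T : ∀ {n} {A : Subset n} {i} → i ∈ A → T (lookup A i)
∈⇒T i∈A = from T-≡ ([]=⇒lookup i∈A)

T⇒∈ : ∀ {n} {A : Subset n} {i} → T (lookup A i) → i ∈ A
T⇒∈ {A = A} {i} t = lookup⇒[]= i A (to T-≡ t)

∉⇒T-not : ∀ {n} {A : Subset n} {i} → i ∉ A → T (not (lookup A i))
∉⇒T-not {A = A} {i} i∉A with lookup A i in eq
... | true  = i∉A (lookup⇒[]= i A eq)
... | false = tt

T-not⇒∉ : ∀ {n} {A : Subset n} {i} → T (not (lookup A i)) → i ∉ A
T-not⇒∉ t i∈A = subst (T ∘ not) ([]=⇒lookup i∈A) t

∣∪∣-disjoint : ∀ {n} (A B : Subset n) → (∀ {i} → i ∈ A → i ∉ B) → ∣ A ∪ B ∣ ≡ ∣ A ∣ +ℕ ∣ B ∣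
∣∪∣-disjoint [] [] _ = refl
∣∪∣-disjoint (true ∷ A) (true ∷ B) disj = ⊥-elim (disj here here)
∣∪∣-disjoint (true ∷ A) (false ∷ B) disj = cong suc (∣∪∣-disjoint A B (λ p q → disj (there p) (there q)))
∣∪∣-disjoint (false ∷ A) (true ∷ B) disj =
  trans (cong suc (∣∪∣-disjoint A B (λ p q → disj (there p) (there q)))) (sym (+-suc ∣ A ∣ ∣ B ∣))
∣∪∣-disjoint (false ∷ A) (false ∷ B) disj = ∣∪∣-disjoint A B (λ p q → disj (there p) (there q))

module _ {n : ℕ} {A : Subset n} {a : Fin n} where

  ∈-insert⁻ : ∀ {i} → i ∈ A ∪ ⁅ a ⁆ → i ∈ A ⊎ i ≡ a
  ∈-insert⁻ i∈ with x∈p∪q⁻ A ⁅ a ⁆ i∈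
  ... | inj₁ i∈A = inj₁ i∈A
  ... | inj₂ i∈a = inj₂ (x∈⁅y⁆⇒x≡y a i∈a)

  ∈-insert-old : ∀ {i} → i ∈ A → i ∈ A ∪ ⁅ a ⁆
  ∈-insert-old i∈A = x∈p∪q⁺ (inj₁ i∈A)

  ∈-insert-new : a ∈ A ∪ ⁅ a ⁆
  ∈-insert-new = x∈p∪q⁺ (inj₂ (x∈⁅x⁆ a))

  ∉-insert : ∀ {i} → i ∉ A → i ≢ a → i ∉ A ∪ ⁅ a ⁆
  ∉-insert i∉A i≢a i∈ with ∈-insert⁻ i∈
  ... | inj₁ i∈A = i∉A i∈A
  ... | inj₂ i≡a = i≢a i≡a

  insert-old : a ∈ A → A ∪ ⁅ a ⁆ ≡ A
  insert-old a∈A = ⊆-antisym old ∈-insert-old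
    where
    old : A ∪ ⁅ a ⁆ ⊆ A
    old i∈ with ∈-insert⁻ i∈
    ... | inj₁ i∈A = i∈A
    ... | inj₂ refl = a∈A

  ∣insert-new∣ : a ∉ A → ∣ A ∪ ⁅ a ⁆ ∣ ≡ suc ∣ A ∣
  ∣insert-new∣ a∉A = begin
    ∣ A ∪ ⁅ a ⁆ ∣      ≡⟨ ∣∪∣-disjoint A ⁅ a ⁆ disjoint ⟩
    ∣ A ∣ +ℕ ∣ ⁅ a ⁆ ∣ ≡⟨ cong (∣ A ∣ +ℕ_) (∣⁅x⁆∣≡1 a) ⟩
    ∣ A ∣ +ℕ 1         ≡⟨ +ℕ-comm ∣ A ∣ 1 ⟩
    suc ∣ A ∣          ∎
    where
    open ≡-Reasoning
    disjoint : ∀ {i} → i ∈ A → i ∉ ⁅ a ⁆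
    disjoint i∈A i∈a = a∉A (subst (_∈ A) (x∈⁅y⁆⇒x≡y a i∈a) i∈A)

∩∁⊥ : ∀ {n} (S : Subset n) → S ∩ ∁ ⊥ ≡ S
∩∁⊥ [] = refl
∩∁⊥ (s ∷ S) = cong₂ _∷_ (∧-identityʳ s) (∩∁⊥ S)

Edge : (G : Graph) → Fin (size G) → Fin (size G) → Set
Edge G i j = T (edge G i j)

edge⁺ : ∀ G {i j} → i ∈ V G → j ∈ V G → T (adj G i j) → Edge G i j
edge⁺ G i∈V j∈V a = from T-∧ (∈⇒T i∈V , from T-∧ (∈⇒T j∈V , a))

edge⁻ : ∀ G {i j} → Edge G i j → i ∈ V G × j ∈ V G × T (adj G i j)
edge⁻ G {i} {j} e with to (T-∧ {lookup (V G) i}) e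
... | i∈V , e′ with to (T-∧ {lookup (V G) j}) e′
... | j∈V , a = T⇒∈ i∈V , T⇒∈ j∈V , a

N₁⁺ : ∀ G {a w} → Edge G a w → w ∈ N₁ G a
N₁⁺ G {a} {w} e = T⇒∈ (subst T (sym (lookup∘tabulate (edge G a) w)) e)

N₁⁻ : ∀ G {a w} → w ∈ N₁ G a → Edge G a w
N₁⁻ G {a} {w} w∈N = subst T (lookup∘tabulate (edge G a) w) (∈⇒T w∈N)

N⁺ : ∀ G W {i j} → j ∈ V G → j ∉ W → i ∈ W → Edge G i j → j ∈ N G W
N⁺ G W {i} {j} j∈V j∉W i∈W e = T⇒∈ (subst T (sym (lookup∘tabulate _ j))
  (from T-∧ (∈⇒T j∈V , from T-∧ (∉⇒T-not j∉W ,
     any⁺ _ (lose (∈-allFin i) (from T-∧ (∈⇒T i∈W , e)))))))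

N⁻ : ∀ G W {j} → j ∈ N G W → j ∈ V G × j ∉ W × ∃ λ i → i ∈ W × Edge G i j
N⁻ G W {j} j∈N with to T-∧ (subst T (lookup∘tabulate _ j) (∈⇒T j∈N))
... | j∈V , rest with to T-∧ rest
... | j∉W , some with satisfied (any⁻ _ (allFin (size G)) some)
... | i , i∈W∧e with to T-∧ i∈W∧e
... | i∈W , e = T⇒∈ j∈V , T-not⇒∉ j∉W , i , T⇒∈ i∈W , e

N-grow : ∀ G {W W′ j} → W ⊆ W′ → j ∈ N G W → j ∉ W′ → j ∈ N G W′
N-grow G {W} {W′} W⊆W′ j∈N j∉W′ with N⁻ G W j∈N
... | j∈V , _ , i , i∈W , e = N⁺ G W′ j∈V j∉W′ (W⊆W′ i∈W) e

V⊖⁺ : ∀ G {X i} → i ∈ V G → i ∉ X → i ∈ V (G ⊖ X)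
V⊖⁺ G i∈V i∉X = x∈p∩q⁺ (i∈V , x∉p⇒x∈∁p i∉X)

V⊖⁻ : ∀ G {X i} → i ∈ V (G ⊖ X) → i ∈ V G × i ∉ X
V⊖⁻ G {X} i∈V⊖ with x∈p∩q⁻ (V G) (∁ X) i∈V⊖
... | i∈V , i∈∁X = i∈V , x∈∁p⇒x∉p i∈∁X

edge⊖⁺ : ∀ G {X i j} → Edge G i j → i ∉ X → j ∉ X → Edge (G ⊖ X) i j
edge⊖⁺ G e i∉X j∉X with edge⁻ G e
... | i∈V , j∈V , a = edge⁺ (G ⊖ _) (V⊖⁺ G i∈V i∉X) (V⊖⁺ G j∈V j∉X) a

edge⊖⁻ : ∀ G {X i j} → Edge (G ⊖ X) i j → Edge G i j
edge⊖⁻ G e with edge⁻ (G ⊖ _) e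
... | i∈V⊖ , j∈V⊖ , a = edge⁺ G (proj₁ (V⊖⁻ G i∈V⊖)) (proj₁ (V⊖⁻ G j∈V⊖)) a

N⊖⁻ : ∀ G {X} W {j} → j ∈ N (G ⊖ X) W → j ∈ N G W × j ∉ X
N⊖⁻ G W j∈N with N⁻ (G ⊖ _) W j∈N
... | j∈V⊖ , j∉W , i , i∈W , e =
  N⁺ G W (proj₁ (V⊖⁻ G j∈V⊖)) j∉W i∈W (edge⊖⁻ G e) , proj₂ (V⊖⁻ G j∈V⊖)

N⊖⁺ : ∀ G {X} W {j} → (∀ {i} → i ∈ W → i ∉ X) → j ∈ N G W → j ∉ X → j ∈ N (G ⊖ X) W
N⊖⁺ G W W∩X=∅ j∈N j∉X with N⁻ G W j∈N
... | j∈V , j∉W , i , i∈W , e = N⁺ (G ⊖ _) W (V⊖⁺ G j∈V j∉X) j∉W i∈W (edge⊖⁺ G e (W∩X=∅ i∈W) j∉X)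

edge\\⁻ : ∀ H {a i j} → Edge (H \\ a) i j → T (adj H i j) ⊎ (Edge H a i × Edge H a j)
edge\\⁻ H {a} {i} {j} e with to (T-∨ {adj H i j}) (proj₂ (proj₂ (edge⁻ (H \\ a) e)))
... | inj₁ a-ij = inj₁ a-ij
... | inj₂ common with to (T-∧ {edge H a i}) common
... | e-ai , rest = inj₂ (e-ai , proj₁ (to (T-∧ {edge H a j}) rest))

edge\\-old : ∀ H {a i j} → i ∈ V (H \\ a) → j ∈ V (H \\ a) → T (adj H i j) → Edge (H \\ a) i j
edge\\-old H i∈V j∈V a-ij = edge⁺ (H \\ _) i∈V j∈V (from T-∨ (inj₁ a-ij))

edge\\-new : ∀ H {a i j} → i ∈ V (H \\ a) → j ∈ V (H \\ a) →
             Edge H a i → Edge H a j → i ≢ j → Edge (H \\ a) i j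
edge\\-new H {a} {i} {j} i∈V j∈V e-ai e-aj i≢j =
  edge⁺ (H \\ a) i∈V j∈V (from (T-∨ {adj H i j}) (inj₂ (from T-∧ (e-ai , from T-∧ (e-aj , distinct)))))
  where
  distinct : T (not ⌊ i ≟ j ⌋)
  distinct with i ≟ j
  ... | yes i≡j = i≢j i≡j
  ... | no _ = tt

N-insert⁻ : ∀ G A {a j} → j ∈ N G (A ∪ ⁅ a ⁆) → j ∈ N G A ⊎ Edge G a j
N-insert⁻ G A j∈N with N⁻ G (A ∪ ⁅ _ ⁆) j∈N
... | j∈V , j∉A+a , i , i∈A+a , e with ∈-insert⁻ i∈A+a
...   | inj₁ i∈A = inj₁ (N⁺ G A j∈V (j∉A+a ∘ ∈-insert-old) i∈A e)
...   | inj₂ refl = inj₂ e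

edge-sym : ∀ G → IsSimple G → ∀ {i j} → Edge G i j → Edge G j i
edge-sym G (symmetric , _) {i} {j} e with edge⁻ G e
... | i∈V , j∈V , a = edge⁺ G j∈V i∈V (subst T (symmetric i j) a)

edge-irrefl : ∀ G → IsSimple G → ∀ {i} → ¬ Edge G i i
edge-irrefl G (_ , loopless) {i} e = subst T (loopless i) (proj₂ (proj₂ (edge⁻ G e)))

module SubsetSums {c ℓ : Level} (R : CommutativeRing c ℓ) where
  open CommutativeRing R renaming (refl to ≈-refl; sym to ≈-sym; trans to ≈-trans)
  open Poly R using (sumL)
  open import Algebra.Properties.CommutativeSemigroup +-commutativeSemigroup using (interchange)
  open import Relation.Binary.Reasoning.Setoid setoid

  when unless : ∀ {p} {P : Set p} → Dec P → Carrier → Carrier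
  when d a = if does d then a else 0#
  unless d a = if does d then 0# else a

  when-yes : ∀ {p} {P : Set p} (d : Dec P) {a} → P → when d a ≈ a
  when-yes (yes _) _ = ≈-refl
  when-yes (no ¬p) p = ⊥-elim (¬p p)

  when-no : ∀ {p} {P : Set p} (d : Dec P) {a} → ¬ P → when d a ≈ 0#
  when-no (yes p) ¬p = ⊥-elim (¬p p)
  when-no (no _) _ = ≈-refl

  unless-yes : ∀ {p} {P : Set p} (d : Dec P) {a} → P → unless d a ≈ 0#
  unless-yes (yes _) _ = ≈-refl
  unless-yes (no ¬p) p = ⊥-elim (¬p p)

  unless-no : ∀ {p} {P : Set p} (d : Dec P) {a} → ¬ P → unless d a ≈ a
  unless-no (yes p) ¬p = ⊥-elim (¬p p)
  unless-no (no _) _ = ≈-refl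

  Σ⊆ : ∀ {n} → Subset n → (Subset n → Carrier) → Carrier
  Σ⊆ [] f = f []
  Σ⊆ (false ∷ S) f = Σ⊆ S (λ W → f (false ∷ W))
  Σ⊆ (true ∷ S) f = Σ⊆ S (λ W → f (false ∷ W)) + Σ⊆ S (λ W → f (true ∷ W))

  sumL-++ : ∀ xs ys → sumL (xs ++ ys) ≈ sumL xs + sumL ys
  sumL-++ L.[] ys = ≈-sym (+-identityˡ _)
  sumL-++ (x L.∷ xs) ys = ≈-trans (+-congˡ (sumL-++ xs ys)) (≈-sym (+-assoc _ _ _))

  sumL-subsetsOf : ∀ {n} (S : Subset n) f → sumL (L.map f (subsetsOf S)) ≈ Σ⊆ S f
  sumL-subsetsOf [] f = +-identityʳ (f [])
  sumL-subsetsOf (false ∷ S) f = begin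
    sumL (L.map f (L.map (false ∷_) (subsetsOf S)))  ≡⟨ ≡.cong sumL (≡.sym (map-∘ (subsetsOf S))) ⟩
    sumL (L.map (λ W → f (false ∷ W)) (subsetsOf S)) ≈⟨ sumL-subsetsOf S _ ⟩
    Σ⊆ S (λ W → f (false ∷ W))                       ∎
  sumL-subsetsOf (true ∷ S) f = begin
    sumL (L.map f (L.map (false ∷_) (subsetsOf S) ++ L.map (true ∷_) (subsetsOf S)))
      ≡⟨ ≡.cong sumL (map-++ f (L.map (false ∷_) (subsetsOf S)) _) ⟩
    sumL (L.map f (L.map (false ∷_) (subsetsOf S)) ++ L.map f (L.map (true ∷_) (subsetsOf S)))
      ≈⟨ sumL-++ (L.map f (L.map (false ∷_) (subsetsOf S))) (L.map f (L.map (true ∷_) (subsetsOf S))) ⟩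
    sumL (L.map f (L.map (false ∷_) (subsetsOf S))) + sumL (L.map f (L.map (true ∷_) (subsetsOf S)))
      ≡⟨ ≡.cong₂ (λ l r → sumL l + sumL r) (≡.sym (map-∘ (subsetsOf S))) (≡.sym (map-∘ (subsetsOf S))) ⟩
    sumL (L.map (λ W → f (false ∷ W)) (subsetsOf S)) + sumL (L.map (λ W → f (true ∷ W)) (subsetsOf S))
      ≈⟨ +-cong (sumL-subsetsOf S _) (sumL-subsetsOf S _) ⟩
    Σ⊆ (true ∷ S) f ∎

  Σ⊆-cong : ∀ {n} (S : Subset n) {f g : Subset n → Carrier} →
            (∀ {W} → W ⊆ S → f W ≈ g W) → Σ⊆ S f ≈ Σ⊆ S g
  Σ⊆-cong [] f≈g = f≈g (λ p → p)
  Σ⊆-cong (false ∷ S) f≈g = Σ⊆-cong S (f≈g ∘ out⊆)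
  Σ⊆-cong (true ∷ S) f≈g = +-cong (Σ⊆-cong S (f≈g ∘ out⊆)) (Σ⊆-cong S (f≈g ∘ s⊆s))

  Σ⊆-+ : ∀ {n} (S : Subset n) (f g : Subset n → Carrier) → Σ⊆ S (λ W → f W + g W) ≈ Σ⊆ S f + Σ⊆ S g
  Σ⊆-+ [] f g = ≈-refl
  Σ⊆-+ (false ∷ S) f g = Σ⊆-+ S _ _
  Σ⊆-+ (true ∷ S) f g = ≈-trans (+-cong (Σ⊆-+ S _ _) (Σ⊆-+ S _ _)) (interchange _ _ _ _)

  Σ⊆-* : ∀ {n} (S : Subset n) a (f : Subset n → Carrier) → Σ⊆ S (λ W → a * f W) ≈ a * Σ⊆ S f
  Σ⊆-* [] a f = ≈-refl
  Σ⊆-* (false ∷ S) a f = Σ⊆-* S a _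
  Σ⊆-* (true ∷ S) a f = ≈-trans (+-cong (Σ⊆-* S a _) (Σ⊆-* S a _)) (≈-sym (distribˡ a _ _))

  Σ⊆-0 : ∀ {n} (S : Subset n) → Σ⊆ S (λ _ → 0#) ≈ 0#
  Σ⊆-0 [] = ≈-refl
  Σ⊆-0 (false ∷ S) = Σ⊆-0 S
  Σ⊆-0 (true ∷ S) = ≈-trans (+-cong (Σ⊆-0 S) (Σ⊆-0 S)) (+-identityˡ 0#)

  Σ⊆-split : ∀ {n} {S : Subset n} {v} (f : Subset n → Carrier) → v ∈ S →
             Σ⊆ S f ≈ Σ⊆ (S ∩ ∁ ⁅ v ⁆) (λ W → f W + f (W ∪ ⁅ v ⁆))
  Σ⊆-split {S = true ∷ S} f here = begin
    Σ⊆ S (λ W → f (false ∷ W)) + Σ⊆ S (λ W → f (true ∷ W))  ≈⟨ Σ⊆-+ S _ _ ⟨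
    Σ⊆ S (λ W → f (false ∷ W) + f (true ∷ W))               ≈⟨ Σ⊆-cong S (λ {W} _ → +-congˡ (reflexive
                                                                  (≡.cong (λ Z → f (true ∷ Z)) (≡.sym (∪-identityʳ W))))) ⟩
    Σ⊆ S (λ W → f (false ∷ W) + f (true ∷ (W ∪ ⊥)))         ≡⟨ ≡.cong (λ Z → Σ⊆ Z _) (≡.sym (∩∁⊥ S)) ⟩
    Σ⊆ (S ∩ ∁ ⊥) (λ W → f (false ∷ W) + f (true ∷ (W ∪ ⊥))) ∎
  Σ⊆-split {S = false ∷ S} f (there v∈S) = Σ⊆-split (λ W → f (false ∷ W)) v∈S
  Σ⊆-split {S = true ∷ S} f (there v∈S) =
    +-cong (Σ⊆-split (λ W → f (false ∷ W)) v∈S) (Σ⊆-split (λ W → f (true ∷ W)) v∈S)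

  Σ⊆-restrict : ∀ {n} (S S′ : Subset n) (f : Subset n → Carrier) → S′ ⊆ S →
                Σ⊆ S (λ W → when (W ⊆? S′) (f W)) ≈ Σ⊆ S′ f
  Σ⊆-restrict [] [] f _ = ≈-refl
  Σ⊆-restrict (false ∷ S) (false ∷ S′) f S′⊆S = Σ⊆-restrict S S′ (λ W → f (false ∷ W)) (drop-∷-⊆ S′⊆S)
  Σ⊆-restrict (false ∷ S) (true ∷ S′) f S′⊆S with () ← S′⊆S here
  Σ⊆-restrict (true ∷ S) (false ∷ S′) f S′⊆S =
    ≈-trans (+-cong (Σ⊆-restrict S S′ (λ W → f (false ∷ W)) (drop-∷-⊆ S′⊆S)) (Σ⊆-0 S)) (+-identityʳ _)
  Σ⊆-restrict (true ∷ S) (true ∷ S′) f S′⊆S =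
    +-cong (Σ⊆-restrict S S′ (λ W → f (false ∷ W)) (drop-∷-⊆ S′⊆S))
           (Σ⊆-restrict S S′ (λ W → f (true ∷ W)) (drop-∷-⊆ S′⊆S))

  Σ⊆-combination : ∀ {n} (S : Subset n) a b c (f g h : Subset n → Carrier) →
    Σ⊆ S (λ W → a * f W + b * (g W + c * h W)) ≈ a * Σ⊆ S f + b * (Σ⊆ S g + c * Σ⊆ S h)
  Σ⊆-combination S a b c f g h = begin
    Σ⊆ S (λ W → a * f W + b * (g W + c * h W))           ≈⟨ Σ⊆-+ S _ _ ⟩
    Σ⊆ S (λ W → a * f W) + Σ⊆ S (λ W → b * (g W + c * h W)) ≈⟨ +-cong (Σ⊆-* S a f) (Σ⊆-* S b _) ⟩
    a * Σ⊆ S f + b * Σ⊆ S (λ W → g W + c * h W)           ≈⟨ +-congˡ (*-congˡ (Σ⊆-+ S g _)) ⟩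
    a * Σ⊆ S f + b * (Σ⊆ S g + Σ⊆ S (λ W → c * h W))      ≈⟨ +-congˡ (*-congˡ (+-congˡ (Σ⊆-* S c h))) ⟩
    a * Σ⊆ S f + b * (Σ⊆ S g + c * Σ⊆ S h)                ∎

module PendantVertex (G : Graph) (simple : IsSimple G) {u v : Fin (size G)}
                     (v∼u : Edge G v u) (only-u : ∀ {w} → Edge G v w → w ≡ u) where

  H : Graph
  H = G ⊖ ⁅ v ⁆

  u∼v : Edge G u v
  u∼v = edge-sym G simple v∼u

  u≢v : u ≢ v
  u≢v refl = edge-irrefl G simple v∼u

  u∈V : u ∈ V G
  u∈V = proj₁ (edge⁻ G u∼v)

  v∈V : v ∈ V G
  v∈V = proj₁ (edge⁻ G v∼u)

  v∉V-H : v ∉ V H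
  v∉V-H v∈VH = proj₂ (V⊖⁻ G v∈VH) (x∈⁅x⁆ v)

  u∈V-H : u ∈ V H
  u∈V-H = V⊖⁺ G u∈V (x≢y⇒x∉⁅y⁆ u≢v)

  v∈N⇒u∈ : ∀ W → v ∈ N G W → u ∈ W
  v∈N⇒u∈ W v∈N with N⁻ G W v∈N
  ... | _ , _ , i , i∈W , i∼v = subst (_∈ W) (only-u (edge-sym G simple i∼v)) i∈W

  N-H⁺ : ∀ W {j} → v ∉ W → j ∈ N G W → j ≢ v → j ∈ N H W
  N-H⁺ W v∉W j∈N j≢v =
    N⊖⁺ G W (λ i∈W i∈v → v∉W (subst (_∈ _) (x∈⁅y⁆⇒x≡y _ i∈v) i∈W)) j∈N (x≢y⇒x∉⁅y⁆ j≢v)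

  N-H⁻ : ∀ W {j} → j ∈ N H W → j ∈ N G W × j ≢ v
  N-H⁻ W j∈N with N⊖⁻ G W j∈N
  ... | j∈NG , j∉v = j∈NG , x∉⁅y⁆⇒x≢y j∉v

  module _ {W : Subset (size G)} (u∉W : u ∉ W) (v∉W : v ∉ W) where

    N-W : N G W ≡ N H W
    N-W = ⊆-antisym (λ j∈N → N-H⁺ W v∉W j∈N (λ { refl → u∉W (v∈N⇒u∈ W j∈N) })) (proj₁ ∘ N-H⁻ W)

    N-W+u : N G (W ∪ ⁅ u ⁆) ≡ N H (W ∪ ⁅ u ⁆) ∪ ⁅ v ⁆
    N-W+u = ⊆-antisym lhs⊆rhs rhs⊆lhs
      where
      v∉W+u : v ∉ W ∪ ⁅ u ⁆
      v∉W+u = ∉-insert v∉W (u≢v ∘ sym)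

      lhs⊆rhs : N G (W ∪ ⁅ u ⁆) ⊆ N H (W ∪ ⁅ u ⁆) ∪ ⁅ v ⁆
      lhs⊆rhs {j} j∈N with j ≟ v
      ... | yes refl = ∈-insert-new
      ... | no j≢v = ∈-insert-old (N-H⁺ (W ∪ ⁅ u ⁆) v∉W+u j∈N j≢v)

      rhs⊆lhs : N H (W ∪ ⁅ u ⁆) ∪ ⁅ v ⁆ ⊆ N G (W ∪ ⁅ u ⁆)
      rhs⊆lhs j∈ with ∈-insert⁻ j∈
      ... | inj₁ j∈N = proj₁ (N-H⁻ (W ∪ ⁅ u ⁆) j∈N)
      ... | inj₂ refl = N⁺ G (W ∪ ⁅ u ⁆) v∈V v∉W+u ∈-insert-new u∼v

    N-W+v : N G (W ∪ ⁅ v ⁆) ≡ N H W ∪ ⁅ u ⁆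
    N-W+v = ⊆-antisym lhs⊆rhs rhs⊆lhs
      where
      lhs⊆rhs : N G (W ∪ ⁅ v ⁆) ⊆ N H W ∪ ⁅ u ⁆
      lhs⊆rhs j∈N with N-insert⁻ G W j∈N
      ... | inj₁ j∈NW = ∈-insert-old (subst (_ ∈_) N-W j∈NW)
      ... | inj₂ v∼j = subst (_∈ _) (sym (only-u v∼j)) ∈-insert-new

      rhs⊆lhs : N H W ∪ ⁅ u ⁆ ⊆ N G (W ∪ ⁅ v ⁆)
      rhs⊆lhs j∈ with ∈-insert⁻ j∈
      ... | inj₁ j∈N with N-H⁻ W j∈N
      ...   | j∈NG , j≢v = N-grow G ∈-insert-old j∈NG (∉-insert (proj₁ (proj₂ (N⁻ G W j∈NG))) j≢v)
      rhs⊆lhs j∈ | inj₂ refl = N⁺ G (W ∪ ⁅ v ⁆) u∈V (∉-insert u∉W u≢v) ∈-insert-new v∼u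

    N-W+u+v : N G ((W ∪ ⁅ u ⁆) ∪ ⁅ v ⁆) ≡ N H (W ∪ ⁅ u ⁆)
    N-W+u+v = ⊆-antisym lhs⊆rhs rhs⊆lhs
      where
      v∉W+u : v ∉ W ∪ ⁅ u ⁆
      v∉W+u = ∉-insert v∉W (u≢v ∘ sym)

      lhs⊆rhs : N G ((W ∪ ⁅ u ⁆) ∪ ⁅ v ⁆) ⊆ N H (W ∪ ⁅ u ⁆)
      lhs⊆rhs j∈N with proj₁ (proj₂ (N⁻ G ((W ∪ ⁅ u ⁆) ∪ ⁅ v ⁆) j∈N)) | N-insert⁻ G (W ∪ ⁅ u ⁆) j∈N
      ... | j∉W+u+v | inj₁ j∈NW+u = N-H⁺ (W ∪ ⁅ u ⁆) v∉W+u j∈NW+u (λ { refl → j∉W+u+v ∈-insert-new })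
      ... | j∉W+u+v | inj₂ v∼j = ⊥-elim (j∉W+u+v (∈-insert-old (subst (_∈ _) (sym (only-u v∼j)) ∈-insert-new)))

      rhs⊆lhs : N H (W ∪ ⁅ u ⁆) ⊆ N G ((W ∪ ⁅ u ⁆) ∪ ⁅ v ⁆)
      rhs⊆lhs j∈N with N-H⁻ (W ∪ ⁅ u ⁆) j∈N
      ... | j∈NG , j≢v = N-grow G ∈-insert-old j∈NG (∉-insert (proj₁ (proj₂ (N⁻ G (W ∪ ⁅ u ⁆) j∈NG))) j≢v)

  N₁-u : N₁ G u ≡ N₁ H u ∪ ⁅ v ⁆
  N₁-u = ⊆-antisym lhs⊆rhs rhs⊆lhs
    where
    lhs⊆rhs : N₁ G u ⊆ N₁ H u ∪ ⁅ v ⁆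
    lhs⊆rhs {j} j∈N with j ≟ v
    ... | yes refl = ∈-insert-new
    ... | no j≢v = ∈-insert-old (N₁⁺ H (edge⊖⁺ G (N₁⁻ G j∈N) (x≢y⇒x∉⁅y⁆ u≢v) (x≢y⇒x∉⁅y⁆ j≢v)))

    rhs⊆lhs : N₁ H u ∪ ⁅ v ⁆ ⊆ N₁ G u
    rhs⊆lhs j∈ with ∈-insert⁻ j∈
    ... | inj₁ j∈N = N₁⁺ G (edge⊖⁻ G (N₁⁻ H j∈N))
    ... | inj₂ refl = N₁⁺ G u∼v

  degree-u : ∣ N₁ G u ∣ ∸ 1 ≡ ∣ N₁ H u ∣
  degree-u = cong (_∸ 1) (trans (cong ∣_∣ N₁-u) (∣insert-new∣ v∉N₁))
    where
    v∉N₁ : v ∉ N₁ H u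
    v∉N₁ v∈N = v∉V-H (proj₁ (proj₂ (edge⁻ H (N₁⁻ H v∈N))))

  -- As v ∈ N_G[u], deleting N_G[u] from G is deleting N_H[u] from H.
  delete-N[u] : G ⊖ N₁[ G ] u ≡ H ⊖ N₁[ H ] u
  delete-N[u] = cong (λ S → mkGraph (size G) S (adj G)) (⊆-antisym lhs⊆rhs rhs⊆lhs)
    where
    lhs⊆rhs : V (G ⊖ N₁[ G ] u) ⊆ V (H ⊖ N₁[ H ] u)
    lhs⊆rhs {i} i∈ with V⊖⁻ G i∈
    ... | i∈V , i∉N[u] = V⊖⁺ H (V⊖⁺ G i∈V (x≢y⇒x∉⁅y⁆ i≢v)) (∉-insert i∉N₁H (i∉N[u] ∘ u-case))
      where
      i≢v : i ≢ v
      i≢v refl = i∉N[u] (∈-insert-old (N₁⁺ G u∼v))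
      i∉N₁H : i ∉ N₁ H u
      i∉N₁H i∈N = i∉N[u] (∈-insert-old (N₁⁺ G (edge⊖⁻ G (N₁⁻ H i∈N))))
      u-case : i ≡ u → i ∈ N₁[ G ] u
      u-case refl = ∈-insert-new

    rhs⊆lhs : V (H ⊖ N₁[ H ] u) ⊆ V (G ⊖ N₁[ G ] u)
    rhs⊆lhs {i} i∈ with V⊖⁻ H i∈
    ... | i∈VH , i∉N[u] = V⊖⁺ G (proj₁ (V⊖⁻ G i∈VH)) i∉N[u]′
      where
      i∉N[u]′ : i ∉ N₁[ G ] u
      i∉N[u]′ i∈N with ∈-insert⁻ i∈N
      ... | inj₁ i∈N₁ = i∉N[u] (∈-insert-old (N₁⁺ H
                          (edge⊖⁺ G (N₁⁻ G i∈N₁) (x≢y⇒x∉⁅y⁆ u≢v) (proj₂ (V⊖⁻ G i∈VH)))))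
      ... | inj₂ refl = i∉N[u] ∈-insert-new

module Contraction (H : Graph) (simple : IsSimple H) {u : Fin (size H)} (u∈V : u ∈ V H) where

  C : Graph
  C = H \\ u

  D : Graph
  D = H ⊖ N₁[ H ] u

  V-C⁺ : ∀ {i} → i ∈ V H → i ≢ u → i ∈ V C
  V-C⁺ i∈V i≢u = V⊖⁺ H i∈V (x≢y⇒x∉⁅y⁆ i≢u)

  V-C⁻ : ∀ {i} → i ∈ V C → i ∈ V H × i ≢ u
  V-C⁻ i∈V with V⊖⁻ H i∈V
  ... | i∈VH , i∉u = i∈VH , x∉⁅y⁆⇒x≢y i∉u

  V-D⊆V-C : V D ⊆ V C
  V-D⊆V-C i∈VD with V⊖⁻ H i∈VD
  ... | i∈V , i∉N[u] = V-C⁺ i∈V (λ { refl → i∉N[u] ∈-insert-new })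

  module _ {W : Subset (size H)} (W⊆V-C : W ⊆ V C) where

    u∉W : u ∉ W
    u∉W u∈W = proj₂ (V-C⁻ (W⊆V-C u∈W)) refl

    avoids-N[u] : u ∉ N H W → ∀ {i} → i ∈ W → i ∉ N₁[ H ] u
    avoids-N[u] u∉N {i} i∈W i∈N[u] with ∈-insert⁻ i∈N[u]
    ... | inj₁ i∈N₁ = u∉N (N⁺ H W u∈V u∉W i∈W (edge-sym H simple (N₁⁻ H i∈N₁)))
    ... | inj₂ refl = u∉W i∈W

    W⊆V-D⇔ : (W ⊆ V D → u ∉ N H W) × (u ∉ N H W → W ⊆ V D)
    W⊆V-D⇔ = in-D⇒ , ⇒in-D
      where
      in-D⇒ : W ⊆ V D → u ∉ N H W
      in-D⇒ W⊆V-D u∈N with N⁻ H W u∈N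
      ... | _ , _ , i , i∈W , i∼u =
        proj₂ (V⊖⁻ H (W⊆V-D i∈W)) (∈-insert-old (N₁⁺ H (edge-sym H simple i∼u)))

      ⇒in-D : u ∉ N H W → W ⊆ V D
      ⇒in-D u∉N i∈W = V⊖⁺ H (proj₁ (V-C⁻ (W⊆V-C i∈W))) (avoids-N[u] u∉N i∈W)

    -- A neighbour of W in C is adjacent to W or, through the new edges, to u.
    N-C-adjacent : u ∈ N H W → N C W ≡ N H (W ∪ ⁅ u ⁆)
    N-C-adjacent u∈N = ⊆-antisym lhs⊆rhs rhs⊆lhs
      where
      lhs⊆rhs : N C W ⊆ N H (W ∪ ⁅ u ⁆)
      lhs⊆rhs j∈N with N⁻ C W j∈N
      ... | j∈VC , j∉W , i , i∈W , i∼j with V-C⁻ j∈VC | edge\\⁻ H i∼j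
      ...   | j∈V , j≢u | inj₁ a =
        N⁺ H _ j∈V (∉-insert j∉W j≢u) (∈-insert-old i∈W) (edge⁺ H (proj₁ (V-C⁻ (W⊆V-C i∈W))) j∈V a)
      ...   | j∈V , j≢u | inj₂ (_ , u∼j) = N⁺ H _ j∈V (∉-insert j∉W j≢u) ∈-insert-new u∼j

      rhs⊆lhs : N H (W ∪ ⁅ u ⁆) ⊆ N C W
      rhs⊆lhs {j} j∈N with N⁻ H (W ∪ ⁅ u ⁆) j∈N | N-insert⁻ H W j∈N
      ... | j∈V , j∉W+u , _ | inj₁ j∈NW with N⁻ H W j∈NW
      ...   | _ , j∉W , i , i∈W , i∼j =
        N⁺ C W j∈VC j∉W i∈W (edge\\-old H (W⊆V-C i∈W) j∈VC (proj₂ (proj₂ (edge⁻ H i∼j))))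
        where
        j∈VC : j ∈ V C
        j∈VC = V-C⁺ j∈V (j∉W+u ∘ λ { refl → ∈-insert-new })
      rhs⊆lhs {j} j∈N | j∈V , j∉W+u , _ | inj₂ u∼j with N⁻ H W u∈N
      ...   | _ , _ , i , i∈W , i∼u =
        N⁺ C W j∈VC (j∉W+u ∘ ∈-insert-old) i∈W
           (edge\\-new H (W⊆V-C i∈W) j∈VC (edge-sym H simple i∼u) u∼j (λ { refl → j∉W+u (∈-insert-old i∈W) }))
        where
        j∈VC : j ∈ V C
        j∈VC = V-C⁺ j∈V (j∉W+u ∘ λ { refl → ∈-insert-new })

    -- Without a neighbour of u in W, no new edge of C meets W.
    N-C-not-adjacent : u ∉ N H W → N C W ≡ N H W
    N-C-not-adjacent u∉N = ⊆-antisym lhs⊆rhs rhs⊆lhs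
      where
      lhs⊆rhs : N C W ⊆ N H W
      lhs⊆rhs {j} j∈N with N⁻ C W j∈N
      ... | j∈VC , j∉W , i , i∈W , i∼j with edge\\⁻ H i∼j
      ...   | inj₁ a = N⁺ H W j∈V j∉W i∈W (edge⁺ H (proj₁ (V-C⁻ (W⊆V-C i∈W))) j∈V a)
        where
        j∈V : j ∈ V H
        j∈V = proj₁ (V-C⁻ j∈VC)
      ...   | inj₂ (u∼i , _) = ⊥-elim (u∉N (N⁺ H W u∈V u∉W i∈W (edge-sym H simple u∼i)))

      rhs⊆lhs : N H W ⊆ N C W
      rhs⊆lhs {j} j∈N with N⁻ H W j∈N
      ... | j∈V , j∉W , i , i∈W , i∼j =
        N⁺ C W j∈VC j∉W i∈W (edge\\-old H (W⊆V-C i∈W) j∈VC (proj₂ (proj₂ (edge⁻ H i∼j))))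
        where
        j∈VC : j ∈ V C
        j∈VC = V-C⁺ j∈V (λ { refl → u∉N j∈N })

    N-W+u-split : u ∉ N H W → N H (W ∪ ⁅ u ⁆) ≡ N₁ H u ∪ N D W
    N-W+u-split u∉N = ⊆-antisym lhs⊆rhs rhs⊆lhs
      where
      lhs⊆rhs : N H (W ∪ ⁅ u ⁆) ⊆ N₁ H u ∪ N D W
      lhs⊆rhs {j} j∈N with N-insert⁻ H W j∈N
      ... | inj₂ u∼j = x∈p∪q⁺ (inj₁ (N₁⁺ H u∼j))
      ... | inj₁ j∈NW with j ∈? N₁ H u
      ...   | yes j∈N₁ = x∈p∪q⁺ (inj₁ j∈N₁)
      ...   | no j∉N₁ = x∈p∪q⁺ (inj₂ (N⊖⁺ H W (avoids-N[u] u∉N) j∈NW (∉-insert j∉N₁ j≢u)))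
        where
        j≢u : j ≢ u
        j≢u refl = u∉N j∈NW

      rhs⊆lhs : N₁ H u ∪ N D W ⊆ N H (W ∪ ⁅ u ⁆)
      rhs⊆lhs {j} j∈ with x∈p∪q⁻ (N₁ H u) (N D W) j∈
      ... | inj₁ j∈N₁ = N⁺ H _ (proj₁ (proj₂ (edge⁻ H u∼j))) (∉-insert j∉W j≢u) ∈-insert-new u∼j
        where
        u∼j : Edge H u j
        u∼j = N₁⁻ H j∈N₁
        j∉W : j ∉ W
        j∉W j∈W = u∉N (N⁺ H W u∈V u∉W j∈W (edge-sym H simple u∼j))
        j≢u : j ≢ u
        j≢u refl = edge-irrefl H simple u∼j
      ... | inj₂ j∈ND with N⊖⁻ H W j∈ND
      ...   | j∈NW , j∉N[u] =
        N-grow H ∈-insert-old j∈NW (∉-insert (proj₁ (proj₂ (N⁻ H W j∈NW))) (λ { refl → j∉N[u] ∈-insert-new }))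

    N₁-N-D-disjoint : ∀ {j} → j ∈ N₁ H u → j ∉ N D W
    N₁-N-D-disjoint j∈N₁ j∈ND = proj₂ (N⊖⁻ H W j∈ND) (∈-insert-old j∈N₁)

module Recurrence {c ℓ : Level} (R : CommutativeRing c ℓ) (x y : CommutativeRing.Carrier R) where
  open CommutativeRing R renaming (refl to ≈-refl; sym to ≈-sym; trans to ≈-trans)
  open Poly R
  open SubsetSums R
  open import Algebra.Properties.Ring ring using (-‿distribˡ-*; -‿distribʳ-*)
  open NC commutativeSemiring using (solve; _:+_; _:*_; _:=_; con)
  open import Relation.Binary.Reasoning.Setoid setoid

  term : (G : Graph) → Subset (size G) → Carrier
  term G W = pow x ∣ W ∣ * pow y ∣ N G W ∣

  J-as-Σ⊆ : ∀ G → J G x y ≈ Σ⊆ (V G) (term G)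
  J-as-Σ⊆ G = sumL-subsetsOf (V G) (term G)

  term-cong : ∀ G W {a b} → ∣ W ∣ ≡ a → ∣ N G W ∣ ≡ b → term G W ≈ pow x a * pow y b
  term-cong G W ∣W∣≡a ∣N∣≡b = reflexive (cong₂ (λ a b → pow x a * pow y b) ∣W∣≡a ∣N∣≡b)

  pow-+ : ∀ m k → pow y (m +ℕ k) ≈ pow y m * pow y k
  pow-+ zero k = ≈-sym (*-identityˡ _)
  pow-+ (suc m) k = ≈-trans (*-congˡ (pow-+ m k)) (≈-sym (*-assoc _ _ _))

  -- The quantity x^|W| (y^|N_H(W+u)| + [u ∉ N_H(W)] y^|N_H(W)|) through which the
  -- pendant step and the contraction step are glued together.
  link : (H : Graph) → Fin (size H) → Subset (size H) → Carrier
  link H u W = pow x ∣ W ∣ * (pow y ∣ N H (W ∪ ⁅ u ⁆) ∣ + unless (u ∈? N H W) (pow y ∣ N H W ∣))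

  -- Moving x·Q across an identity produces the factor y - 1 of the recurrence.
  cancel : ∀ L M Q → L + x * Q ≈ M + x * y * Q → L ≈ M + x * (y - 1#) * Q
  cancel L M Q eq = begin
    L                                   ≈⟨ +-identityʳ L ⟨
    L + 0#                              ≈⟨ +-congˡ (-‿inverseʳ (x * Q)) ⟨
    L + (x * Q - x * Q)                 ≈⟨ +-assoc L (x * Q) (- (x * Q)) ⟨
    (L + x * Q) - x * Q                 ≈⟨ +-congʳ eq ⟩
    (M + x * y * Q) - x * Q             ≈⟨ +-assoc M (x * y * Q) (- (x * Q)) ⟩
    M + (x * y * Q - x * Q)             ≈⟨ +-congˡ factor ⟩
    M + x * (y - 1#) * Q                ∎
    where
    factor : x * y * Q - x * Q ≈ x * (y - 1#) * Q
    factor = begin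
      x * y * Q - x * Q                 ≈⟨ +-congˡ (-‿distribˡ-* x Q) ⟩
      x * y * Q + (- x) * Q             ≈⟨ distribʳ Q (x * y) (- x) ⟨
      (x * y - x) * Q                   ≈⟨ *-congʳ (+-congˡ (-‿cong (*-identityʳ x))) ⟨
      (x * y - x * 1#) * Q              ≈⟨ *-congʳ (+-congˡ (-‿distribʳ-* x 1#)) ⟩
      (x * y + x * (- 1#)) * Q          ≈⟨ *-congʳ (distribˡ x y (- 1#)) ⟨
      x * (y - 1#) * Q                  ∎

  -- Inserting a into A multiplies y^|A| by y exactly when a ∉ A; in a form that
  -- avoids case distinctions later on.
  insert-shift : ∀ {n} (A : Subset n) a →
    pow y ∣ A ∪ ⁅ a ⁆ ∣ + unless (a ∈? A) (pow y ∣ A ∣) ≈ pow y ∣ A ∣ + y * unless (a ∈? A) (pow y ∣ A ∣)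
  insert-shift A a with a ∈? A
  ... | yes a∈A = begin
    pow y ∣ A ∪ ⁅ a ⁆ ∣ + 0#  ≡⟨ cong (λ B → pow y ∣ B ∣ + 0#) (insert-old a∈A) ⟩
    pow y ∣ A ∣ + 0#          ≈⟨ +-congˡ (zeroʳ y) ⟨
    pow y ∣ A ∣ + y * 0#      ∎
  ... | no a∉A = begin
    pow y ∣ A ∪ ⁅ a ⁆ ∣ + pow y ∣ A ∣  ≡⟨ cong (λ k → pow y k + pow y ∣ A ∣) (∣insert-new∣ a∉A) ⟩
    y * pow y ∣ A ∣ + pow y ∣ A ∣      ≈⟨ +-comm _ _ ⟩
    pow y ∣ A ∣ + y * pow y ∣ A ∣      ∎

  -- The algebra of the pendant step, for Y⁺ = y^|N_H(W) ∪ ⁅ u ⁆| and U the indicator term.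
  pendant-algebra : ∀ X Y Y⁺ Z U → Y⁺ + U ≈ Y + y * U →
    (X * Y + (x * X) * Y⁺) + ((x * X) * (y * Z) + (x * (x * X)) * Z)
      ≈ (1# + x) * (X * Y + (x * X) * Z) + x * (y - 1#) * (X * (Z + U))
  pendant-algebra X Y Y⁺ Z U shift = cancel _ _ _ (begin
    ((X * Y + (x * X) * Y⁺) + ((x * X) * (y * Z) + (x * (x * X)) * Z)) + x * (X * (Z + U))
      ≈⟨ regroup x y X Y Y⁺ Z U ⟩
    rest + (x * X) * (Y⁺ + U)
      ≈⟨ +-congˡ (*-congˡ shift) ⟩
    rest + (x * X) * (Y + y * U)
      ≈⟨ expand x y X Y Z U ⟩
    (1# + x) * (X * Y + (x * X) * Z) + x * y * (X * (Z + U)) ∎)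
    where
    rest : Carrier
    rest = ((X * Y + (x * X) * (y * Z)) + (x * (x * X)) * Z) + x * (X * Z)

    regroup : ∀ x y X Y Y⁺ Z U →
      ((X * Y + (x * X) * Y⁺) + ((x * X) * (y * Z) + (x * (x * X)) * Z)) + x * (X * (Z + U))
        ≈ (((X * Y + (x * X) * (y * Z)) + (x * (x * X)) * Z) + x * (X * Z)) + (x * X) * (Y⁺ + U)
    regroup = solve 7 (λ x y X Y Y⁺ Z U →
      ((X :* Y :+ (x :* X) :* Y⁺) :+ ((x :* X) :* (y :* Z) :+ (x :* (x :* X)) :* Z)) :+ x :* (X :* (Z :+ U))
        := (((X :* Y :+ (x :* X) :* (y :* Z)) :+ (x :* (x :* X)) :* Z) :+ x :* (X :* Z)) :+ (x :* X) :* (Y⁺ :+ U))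
      ≈-refl

    expand : ∀ x y X Y Z U →
      (((X * Y + (x * X) * (y * Z)) + (x * (x * X)) * Z) + x * (X * Z)) + (x * X) * (Y + y * U)
        ≈ (1# + x) * (X * Y + (x * X) * Z) + x * y * (X * (Z + U))
    expand = solve 6 (λ x y X Y Z U →
      (((X :* Y :+ (x :* X) :* (y :* Z)) :+ (x :* (x :* X)) :* Z) :+ x :* (X :* Z)) :+ (x :* X) :* (Y :+ y :* U)
        := (con 1 :+ x) :* (X :* Y :+ (x :* X) :* Z) :+ x :* y :* (X :* (Z :+ U)))
      ≈-refl

  module _ (G : Graph) (simple : IsSimple G) {u v : Fin (size G)}
           (v∼u : Edge G v u) (only-u : ∀ {w} → Edge G v w → w ≡ u) where
    open PendantVertex G simple v∼u only-u

    module _ {W : Subset (size G)} (u∉W : u ∉ W) (v∉W : v ∉ W) where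
      private
        X : Carrier
        X = pow x ∣ W ∣
        Y : Carrier
        Y = pow y ∣ N H W ∣
        Z : Carrier
        Z = pow y ∣ N H (W ∪ ⁅ u ⁆) ∣

        ∣W+u∣ : ∣ W ∪ ⁅ u ⁆ ∣ ≡ suc ∣ W ∣
        ∣W+u∣ = ∣insert-new∣ u∉W

      four-summands :
        (term G W + term G (W ∪ ⁅ v ⁆)) + (term G (W ∪ ⁅ u ⁆) + term G ((W ∪ ⁅ u ⁆) ∪ ⁅ v ⁆))
          ≈ (X * Y + (x * X) * pow y ∣ N H W ∪ ⁅ u ⁆ ∣) + ((x * X) * (y * Z) + (x * (x * X)) * Z)
      four-summands = +-cong (+-cong t-W t-W+v) (+-cong t-W+u t-W+u+v)
        where
        t-W : term G W ≈ X * Y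
        t-W = term-cong G W refl (cong ∣_∣ (N-W u∉W v∉W))

        t-W+v : term G (W ∪ ⁅ v ⁆) ≈ (x * X) * pow y ∣ N H W ∪ ⁅ u ⁆ ∣
        t-W+v = term-cong G (W ∪ ⁅ v ⁆) (∣insert-new∣ v∉W) (cong ∣_∣ (N-W+v u∉W v∉W))

        t-W+u : term G (W ∪ ⁅ u ⁆) ≈ (x * X) * (y * Z)
        t-W+u = term-cong G (W ∪ ⁅ u ⁆) ∣W+u∣ (trans (cong ∣_∣ (N-W+u u∉W v∉W))
                  (∣insert-new∣ (v∉V-H ∘ proj₁ ∘ N⁻ H (W ∪ ⁅ u ⁆))))

        t-W+u+v : term G ((W ∪ ⁅ u ⁆) ∪ ⁅ v ⁆) ≈ (x * (x * X)) * Z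
        t-W+u+v = term-cong G ((W ∪ ⁅ u ⁆) ∪ ⁅ v ⁆)
                    (trans (∣insert-new∣ (∉-insert v∉W (u≢v ∘ sym))) (cong suc ∣W+u∣))
                    (cong ∣_∣ (N-W+u+v u∉W v∉W))

      pendant-step :
        (term G W + term G (W ∪ ⁅ v ⁆)) + (term G (W ∪ ⁅ u ⁆) + term G ((W ∪ ⁅ u ⁆) ∪ ⁅ v ⁆))
          ≈ (1# + x) * (term H W + term H (W ∪ ⁅ u ⁆)) + x * (y - 1#) * link H u W
      pendant-step = begin
        (term G W + term G (W ∪ ⁅ v ⁆)) + (term G (W ∪ ⁅ u ⁆) + term G ((W ∪ ⁅ u ⁆) ∪ ⁅ v ⁆))
          ≈⟨ four-summands ⟩
        (X * Y + (x * X) * pow y ∣ N H W ∪ ⁅ u ⁆ ∣) + ((x * X) * (y * Z) + (x * (x * X)) * Z)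
          ≈⟨ pendant-algebra X Y _ Z _ (insert-shift (N H W) u) ⟩
        (1# + x) * (X * Y + (x * X) * Z) + x * (y - 1#) * link H u W
          ≈⟨ +-congʳ (*-congˡ (+-congˡ (term-cong H (W ∪ ⁅ u ⁆) ∣W+u∣ refl))) ⟨
        (1# + x) * (term H W + term H (W ∪ ⁅ u ⁆)) + x * (y - 1#) * link H u W ∎

  module _ (H : Graph) (simple : IsSimple H) {u : Fin (size H)} (u∈V : u ∈ V H) where
    open Contraction H simple u∈V

    J-split-u : J H x y ≈ Σ⊆ (V C) (λ W → term H W + term H (W ∪ ⁅ u ⁆))
    J-split-u = ≈-trans (J-as-Σ⊆ H) (Σ⊆-split (term H) u∈V)

    J-D-restricted : J D x y ≈ Σ⊆ (V C) (λ W → when (W ⊆? V D) (term D W))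
    J-D-restricted = ≈-trans (J-as-Σ⊆ D) (≈-sym (Σ⊆-restrict (V C) (V D) (term D) V-D⊆V-C))

    module _ {W : Subset (size H)} (W⊆V-C : W ⊆ V C) where
      private
        X : Carrier
        X = pow x ∣ W ∣
        Y : Carrier
        Y = pow y ∣ N H W ∣
        Z : Carrier
        Z = pow y ∣ N H (W ∪ ⁅ u ⁆) ∣
        Yᵤ : Carrier
        Yᵤ = pow y ∣ N₁ H u ∣

      -- If u has a neighbour in W, W contributes nothing to J(D).
      contraction-adjacent : u ∈ N H W →
        link H u W ≈ term C W + Yᵤ * when (W ⊆? V D) (term D W)
      contraction-adjacent u∈N = begin
        link H u W      ≈⟨ *-congˡ (+-congˡ (unless-yes (u ∈? N H W) u∈N)) ⟩
        X * (Z + 0#)    ≈⟨ algebra X Z Yᵤ ⟩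
        X * Z + Yᵤ * 0# ≈⟨ +-cong (term-cong C W refl (cong ∣_∣ (N-C-adjacent W⊆V-C u∈N)))
                                  (*-congˡ (when-no (W ⊆? V D) (λ W⊆V-D → proj₁ (W⊆V-D⇔ W⊆V-C) W⊆V-D u∈N))) ⟨
        term C W + Yᵤ * when (W ⊆? V D) (term D W) ∎
        where
        algebra : ∀ X Z Yᵤ → X * (Z + 0#) ≈ X * Z + Yᵤ * 0#
        algebra = solve 3 (λ X Z Yᵤ → X :* (Z :+ con 0) := X :* Z :+ Yᵤ :* con 0) ≈-refl

      -- Otherwise W lies in D and y^|N_H(W + u)| factors as y^|N_H(u)| · y^|N_D(W)|.
      contraction-apart : u ∉ N H W →
        link H u W ≈ term C W + Yᵤ * when (W ⊆? V D) (term D W)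
      contraction-apart u∉N = begin
        link H u W           ≈⟨ *-congˡ (+-congˡ (unless-no (u ∈? N H W) u∉N)) ⟩
        X * (Z + Y)          ≈⟨ *-congˡ (+-congʳ Z≈Yᵤ*E) ⟩
        X * (Yᵤ * E + Y)     ≈⟨ algebra X Y Yᵤ E ⟩
        X * Y + Yᵤ * (X * E) ≈⟨ +-cong (term-cong C W refl (cong ∣_∣ (N-C-not-adjacent W⊆V-C u∉N)))
                                       (*-congˡ (when-yes (W ⊆? V D) (proj₂ (W⊆V-D⇔ W⊆V-C) u∉N))) ⟨
        term C W + Yᵤ * when (W ⊆? V D) (term D W) ∎
        where
        E : Carrier
        E = pow y ∣ N D W ∣

        Z≈Yᵤ*E : Z ≈ Yᵤ * E
        Z≈Yᵤ*E = begin
          Z                                ≡⟨ cong (pow y) (trans (cong ∣_∣ (N-W+u-split W⊆V-C u∉N))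
                                                (∣∪∣-disjoint (N₁ H u) (N D W) (N₁-N-D-disjoint W⊆V-C))) ⟩
          pow y (∣ N₁ H u ∣ +ℕ ∣ N D W ∣)  ≈⟨ pow-+ ∣ N₁ H u ∣ ∣ N D W ∣ ⟩
          Yᵤ * E                           ∎

        algebra : ∀ X Y Yᵤ E → X * (Yᵤ * E + Y) ≈ X * Y + Yᵤ * (X * E)
        algebra = solve 4 (λ X Y Yᵤ E → X :* (Yᵤ :* E :+ Y) := X :* Y :+ Yᵤ :* (X :* E)) ≈-refl

      contraction-step : link H u W ≈ term C W + Yᵤ * when (W ⊆? V D) (term D W)
      contraction-step = by-cases (u ∈? N H W)
        where
        by-cases : Dec (u ∈ N H W) → link H u W ≈ term C W + Yᵤ * when (W ⊆? V D) (term D W)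
        by-cases (yes u∈N) = contraction-adjacent u∈N
        by-cases (no u∉N) = contraction-apart u∉N

  pendant-recurrence : ∀ G → IsSimple G → ∀ {u v} → Edge G v u → (∀ {w} → Edge G v w → w ≡ u) →
    J G x y ≈ (1# + x) * J (G ⊖ ⁅ v ⁆) x y
              + x * (y - 1#) * (J ((G ⊖ ⁅ v ⁆) \\ u) x y
                                + pow y (∣ N₁ G u ∣ ∸ 1) * J (G ⊖ N₁[ G ] u) x y)
  pendant-recurrence G simple {u} {v} v∼u only-u = begin
    J G x y
      ≈⟨ J-as-Σ⊆ G ⟩
    Σ⊆ (V G) (term G)
      ≈⟨ Σ⊆-split (term G) v∈V ⟩
    Σ⊆ (V H) (λ W → term G W + term G (W ∪ ⁅ v ⁆))
      ≈⟨ Σ⊆-split _ u∈V-H ⟩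
    Σ⊆ (V C) (λ W → (term G W + term G (W ∪ ⁅ v ⁆)) + (term G (W ∪ ⁅ u ⁆) + term G ((W ∪ ⁅ u ⁆) ∪ ⁅ v ⁆)))
      ≈⟨ Σ⊆-cong (V C) summand ⟩
    Σ⊆ (V C) (λ W → (1# + x) * (term H W + term H (W ∪ ⁅ u ⁆))
                    + x * (y - 1#) * (term C W + Yᵤ * when (W ⊆? V D) (term D W)))
      ≈⟨ Σ⊆-combination (V C) _ _ _ _ _ _ ⟩
    (1# + x) * Σ⊆ (V C) (λ W → term H W + term H (W ∪ ⁅ u ⁆))
      + x * (y - 1#) * (Σ⊆ (V C) (term C) + Yᵤ * Σ⊆ (V C) (λ W → when (W ⊆? V D) (term D W)))
      ≈⟨ +-cong (*-congˡ (J-split-u H simple u∈V-H))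
                (*-congˡ (+-cong (J-as-Σ⊆ C) (*-cong (reflexive (cong (pow y) degree-u)) J-G-N[u]))) ⟨
    (1# + x) * J H x y + x * (y - 1#) * (J C x y + pow y (∣ N₁ G u ∣ ∸ 1) * J (G ⊖ N₁[ G ] u) x y) ∎
    where
    open PendantVertex G simple v∼u only-u using (H; v∈V; u∈V-H; v∉V-H; degree-u; delete-N[u])
    open Contraction H simple u∈V-H using (C; D; V-C⁻; u∉W)

    Yᵤ : Carrier
    Yᵤ = pow y ∣ N₁ H u ∣

    summand : ∀ {W} → W ⊆ V C →
      (term G W + term G (W ∪ ⁅ v ⁆)) + (term G (W ∪ ⁅ u ⁆) + term G ((W ∪ ⁅ u ⁆) ∪ ⁅ v ⁆))
        ≈ (1# + x) * (term H W + term H (W ∪ ⁅ u ⁆))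
          + x * (y - 1#) * (term C W + Yᵤ * when (W ⊆? V D) (term D W))
    summand {W} W⊆V-C = ≈-trans (pendant-step G simple v∼u only-u (u∉W W⊆V-C) v∉W)
                            (+-congˡ (*-congˡ (contraction-step H simple u∈V-H W⊆V-C)))
      where
      v∉W : v ∉ W
      v∉W v∈W = v∉V-H (proj₁ (V-C⁻ (W⊆V-C v∈W)))

    J-G-N[u] : J (G ⊖ N₁[ G ] u) x y ≈ Σ⊆ (V C) (λ W → when (W ⊆? V D) (term D W))
    J-G-N[u] = ≈-trans (reflexive (cong (λ K → J K x y) delete-N[u])) (J-D-restricted H simple u∈V-H)

corollary3 : {c ℓ : Level} (R : CommutativeRing c ℓ) (G : Graph) → IsSimple G →
    (u v : Fin (size G)) → lookup (V G) v ≡ true →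
    (∀ w → (edge G v w ≡ true → w ≡ u) × (w ≡ u → edge G v w ≡ true)) →
    (x y : CommutativeRing.Carrier R) →
    let open CommutativeRing R
        open Poly R
    in J G x y ≈ (1# + x) * J (G ⊖ ⁅ v ⁆) x y
         + x * (y - 1#) * (J ((G ⊖ ⁅ v ⁆) \\ u) x y
           + pow y (∣ N₁ G u ∣ ∸ 1) * J (G ⊖ N₁[ G ] u) x y)
corollary3 R G simple u v _ neighbours-of-v x y = Recurrence.pendant-recurrence R x y G simple v∼u only-u
  where
  v∼u : Edge G v u
  v∼u = from T-≡ (proj₂ (neighbours-of-v u) refl)

  only-u : ∀ {w} → Edge G v w → w ≡ u
  only-u {w} v∼w = proj₁ (neighbours-of-v w) (to T-≡ v∼w)
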